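{- Let $n,k$ be positive integers with $k\ge 2$. For every $s, t \in \mathbb{Z}_k$ with $t \neq 0$, \[ |Y(s,t)| = \begin{cases} (k^{n-1}-1)/(k-1) + 1 & \text{if } s = t,\\ (k^{n-1}-1)/(k-1) & \text{otherwise.}\end{cases}\]
   Context: Vertices of the Hamming graph $H(n,k)$ are vectors $v=(v(1),\dots,v(n))\in \mathbb{Z}_k^n$ with $\mathbb{Z}_k=\{0,1,\dots,k-1\}$; all arithmetic is modulo $k$. For $v \neq (0,\dots,0)$, $\ell(v)$ is the largest index $1\le i\le n$ with $v(i)\neq 0$. For $s,t\in\mathbb{Z}_k$ with $t\neq 0$, $Y(s,t)$ is the set of nonzero vertices $v$ with $\sum_{i=1}^n v(i)\equiv s \pmod k$ and $v(\ell(v)) = t$. -}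

module Defs where

open import Data.Nat using (ℕ; zero; suc; _+_; _%_; NonZero)
open import Data.Fin using (Fin; toℕ; fromℕ<) renaming (zero to fzero)
open import Data.Fin.Properties using (_≟_)
open import Data.Vec using (Vec; []; _∷_; foldr)
open import Data.List using (List; []; _∷_; map; concatMap; allFin; length; filter)
open import Data.Maybe using (Maybe; just; nothing)
open import Data.Product using (_×_)
open import Relation.Nullary using (Dec; yes; no; ¬_)
open import Relation.Nullary.Decidable using (_×-dec_; ¬?)
open import Relation.Binary.PropositionalEquality using (_≡_)
open import Data.Maybe.Properties using () renaming (≡-dec to ≡-dec-Maybe)

Vertex : ℕ → ℕ → Set
Vertex n k = Vec (Fin k) n

allVertices : (n k : ℕ) → List (Vertex n k)
allVertices zero    k = [] ∷ []
allVertices (suc n) k = concatMap (λ a → map (a ∷_) (allVertices n k)) (allFin k)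

sumℕ : ∀ {n k} → Vertex n k → ℕ
sumℕ = foldr _ (λ a acc → toℕ a + acc) 0

isZero : ∀ {k} → Fin k → Set
isZero {zero}  ()
isZero {suc k} a = a ≡ fzero

isZero? : ∀ {k} (a : Fin k) → Dec (isZero a)
isZero? {suc k} a = a ≟ fzero

-- lastNonzero v = just v(ℓ(v)) if v ≠ 0 (the entry at the largest index
-- with nonzero entry), and nothing if v is the zero vector.
lastNonzero : ∀ {n k} → Vertex n k → Maybe (Fin k)
lastNonzero [] = nothing
lastNonzero (a ∷ v) with lastNonzero v
... | just b  = just b
... | nothing with isZero? a
...   | yes _ = nothing
...   | no  _ = just a

-- Membership in Y(s,t) (for t ≠ 0): v nonzero, sum ≡ s (mod k), v(ℓ(v)) = t.
-- Since t ≠ 0, "lastNonzero v ≡ just t" already entails v ≠ 0.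
InY : ∀ {n k} → .{{NonZero k}} → Fin k → Fin k → Vertex n k → Set
InY {k = k} s t v = (sumℕ v % k ≡ toℕ s) × (lastNonzero v ≡ just t)

InY? : ∀ {n k} .{{_ : NonZero k}} (s t : Fin k) (v : Vertex n k) → Dec (InY s t v)
InY? {k = k} s t v =
  (Data.Nat._≟_ (sumℕ v % k) (toℕ s)) ×-dec ≡-dec-Maybe _≟_ (lastNonzero v) (just t)

cardY : (n k : ℕ) → .{{NonZero k}} → Fin k → Fin k → ℕ
cardY n k s t = length (filter (InY? s t) (allVertices n k))

{-# OPTIONS --safe #-}
-- Vertices are built head first, v = a ∷ w. If w ≠ 0 then ℓ(v) lies in w and
-- v ∈ Y(s,t) iff w ∈ Y(s − a,t); if w = 0 then v ∈ Y(s,t) iff a = t = s. Summing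
-- over a, the targets s − a run once through ℤ_k, so with N_n(c) = |Y_n(s − c,t)|
--   N_{n+1}(c) = ∑_{a ∈ ℤ_k} N_n(c + a) + [c + t ≡ s],
-- whose solution is N_{n+1}(c) = R_n + [c + t ≡ s], R_n = (k^n − 1)/(k − 1) the
-- base-k repunit, because ∑_a [c + a + t ≡ s] = 1.
module Submission where

open import Defs
open import Data.Bool using (true; false; if_then_else_)
open import Data.Fin using (Fin; toℕ; inject₁; fromℕ) renaming (zero to fzero; suc to fsuc)
open import Data.Fin.Properties using (_≟_; toℕ-injective; toℕ<n; toℕ-inject₁; toℕ-fromℕ)
open import Data.List using (List; []; _∷_; _++_; map; concatMap; allFin; length; filter; tabulate)
open import Data.List.Properties using (map-++; map-tabulate; map-cong; map-∘)
import Data.Nat.ListAction as ListAction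
open import Data.Nat.ListAction.Properties using (sum-++)
open import Data.Maybe using (Maybe; just; nothing; _<∣>_)
open import Data.Maybe.Properties using () renaming (≡-dec to ≡-dec-Maybe)
open import Data.Nat using (ℕ; zero; suc; _+_; _*_; _^_; _∸_; _/_; _%_; _≤_; NonZero)
import Data.Nat as ℕ
open import Data.Nat.DivMod using ([m+n]%n≡m%n; m<n⇒m%n≡m; m*n/n≡m)
open import Data.Nat.Properties
  using ( +-commutativeSemigroup; +-*-semiring; +-identityʳ; +-comm; +-assoc; +-cancelʳ-≡
        ; *-zeroʳ; *-identityʳ; *-assoc; m+n∸n≡m)
open import Algebra.Properties.CommutativeSemigroup +-commutativeSemigroup using (xy∙z≈xz∙y)
open import Algebra.Properties.Semiring.Sum +-*-semiring
  using (sum-syntax; sum-cong-≗; ∑-distrib-+; sum-replicate-zero; sum-init-last)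
open import Data.Nat.Solver using (module +-*-Solver)
open import Data.Product using (_×_; _,_)
open import Data.Vec using ([]; _∷_; replicate)
open import Function using (_∘_; id)
open import Relation.Nullary using (Dec; does; yes; no; ¬_; contradiction)
open import Relation.Nullary.Decidable using (_×-dec_)
open import Relation.Binary.Definitions using (DecidableEquality)
open import Relation.Binary.PropositionalEquality
  using (_≡_; _≢_; refl; sym; trans; cong; cong₂; module ≡-Reasoning)

𝟙 : ∀ {a} {A : Set a} → Dec A → ℕ
𝟙 p = if does p then 1 else 0

module _ {a} {A : Set a} where

  𝟙-yes : A → (p : Dec A) → 𝟙 p ≡ 1
  𝟙-yes _ (yes _) = refl
  𝟙-yes x (no ¬x) = contradiction x ¬x

  𝟙-no : ¬ A → (p : Dec A) → 𝟙 p ≡ 0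
  𝟙-no ¬x (yes x) = contradiction x ¬x
  𝟙-no _  (no _)  = refl

module _ {a b} {A : Set a} {B : Set b} where

  𝟙-cong : (A → B) → (B → A) → (p : Dec A) (q : Dec B) → 𝟙 p ≡ 𝟙 q
  𝟙-cong f g (yes _) (yes _) = refl
  𝟙-cong f g (yes x) (no ¬y) = contradiction (f x) ¬y
  𝟙-cong f g (no ¬x) (yes y) = contradiction (g y) ¬x
  𝟙-cong f g (no _)  (no _)  = refl

  𝟙-×-dec : (p : Dec A) (q : Dec B) → 𝟙 (p ×-dec q) ≡ 𝟙 p * 𝟙 q
  𝟙-×-dec (yes _) q = sym (+-identityʳ (𝟙 q))
  𝟙-×-dec (no _)  q = refl

length-filter≡sum-𝟙 : ∀ {a p} {A : Set a} {P : A → Set p} (P? : ∀ x → Dec (P x)) (xs : List A) →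
  length (filter P? xs) ≡ ListAction.sum (map (𝟙 ∘ P?) xs)
length-filter≡sum-𝟙 P? [] = refl
length-filter≡sum-𝟙 P? (x ∷ xs) with does (P? x)
... | true  = cong suc (length-filter≡sum-𝟙 P? xs)
... | false = length-filter≡sum-𝟙 P? xs

sum-concatMap : ∀ {a b} {A : Set a} {B : Set b} (f : A → List B) (g : B → ℕ) (xs : List A) →
  ListAction.sum (map g (concatMap f xs)) ≡ ListAction.sum (map (λ x → ListAction.sum (map g (f x))) xs)
sum-concatMap f g [] = refl
sum-concatMap f g (x ∷ xs) = begin
  ListAction.sum (map g (f x ++ concatMap f xs))
    ≡⟨ cong ListAction.sum (map-++ g (f x) (concatMap f xs)) ⟩
  ListAction.sum (map g (f x) ++ map g (concatMap f xs))
    ≡⟨ sum-++ (map g (f x)) (map g (concatMap f xs)) ⟩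
  ListAction.sum (map g (f x)) + ListAction.sum (map g (concatMap f xs))
    ≡⟨ cong (ListAction.sum (map g (f x)) +_) (sum-concatMap f g xs) ⟩
  ListAction.sum (map g (f x)) + ListAction.sum (map (λ x → ListAction.sum (map g (f x))) xs) ∎
  where open ≡-Reasoning

sum-tabulate : ∀ {n} (f : Fin n → ℕ) → ListAction.sum (tabulate f) ≡ ∑[ i < n ] f i
sum-tabulate {zero}  f = refl
sum-tabulate {suc n} f = cong (f fzero +_) (sum-tabulate (f ∘ fsuc))

sum-map-allFin : ∀ {n} (f : Fin n → ℕ) → ListAction.sum (map f (allFin n)) ≡ ∑[ i < n ] f i
sum-map-allFin f = trans (cong ListAction.sum (map-tabulate id f)) (sum-tabulate f)

∑-const : ∀ n x → ∑[ i < n ] x ≡ n * x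
∑-const zero    x = refl
∑-const (suc n) x = cong (x +_) (∑-const n x)

∑-select : ∀ {n} (u : Fin n) (f : Fin n → ℕ) → ∑[ i < n ] (𝟙 (i ≟ u) * f i) ≡ f u
∑-select {suc n} fzero    f = trans (cong₂ _+_ (+-identityʳ (f fzero)) (sum-replicate-zero n)) (+-identityʳ (f fzero))
∑-select {suc n} (fsuc u) f = ∑-select u (f ∘ fsuc)

∑-rotate : ∀ n (h : ℕ → ℕ) → h n ≡ h 0 → ∑[ i < n ] h (suc (toℕ i)) ≡ ∑[ i < n ] h (toℕ i)
∑-rotate n h hn≡h0 = +-cancelʳ-≡ (h 0) _ _ (begin
  ∑[ i < n ] h (suc (toℕ i)) + h 0            ≡⟨ +-comm _ (h 0) ⟩
  ∑[ i < suc n ] h (toℕ i)                   ≡⟨ sum-init-last (h ∘ toℕ) ⟩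
  ∑[ i < n ] h (toℕ (inject₁ i)) + h (toℕ (fromℕ n))
    ≡⟨ cong₂ _+_ (sum-cong-≗ {n} (cong h ∘ toℕ-inject₁)) (trans (cong h (toℕ-fromℕ n)) hn≡h0) ⟩
  ∑[ i < n ] h (toℕ i) + h 0                  ∎)
  where open ≡-Reasoning

∑-periodic-window : ∀ n (h : ℕ → ℕ) → (∀ x → h (x + n) ≡ h x) →
  ∀ x → ∑[ i < n ] h (x + toℕ i) ≡ ∑[ i < n ] h (toℕ i)
∑-periodic-window n h h-periodic zero    = refl
∑-periodic-window n h h-periodic (suc x) =
  trans (∑-periodic-window n (h ∘ suc) (h-periodic ∘ suc) x) (∑-rotate n h (h-periodic 0))

𝟙-toℕ%≟ : ∀ {k} (i s : Fin (suc k)) → 𝟙 (toℕ i % suc k ℕ.≟ toℕ s) ≡ 𝟙 (i ≟ s)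
𝟙-toℕ%≟ {k} i s = 𝟙-cong (λ e → toℕ-injective (trans (sym i%≡i) e)) (λ e → trans i%≡i (cong toℕ e))
  (toℕ i % suc k ℕ.≟ toℕ s) (i ≟ s)
  where
  i%≡i : toℕ i % suc k ≡ toℕ i
  i%≡i = m<n⇒m%n≡m (toℕ<n i)

_≟ᵐ_ : ∀ {k} → DecidableEquality (Maybe (Fin k))
_≟ᵐ_ = ≡-dec-Maybe _≟_

∑ᵛ : ∀ {k} n → (Vertex n k → ℕ) → ℕ
∑ᵛ zero    g = g []
∑ᵛ {k} (suc n) g = ∑[ a < k ] ∑ᵛ n (λ w → g (a ∷ w))

module _ {k : ℕ} where

  ∑ᵛ-cong : ∀ n {f g : Vertex n k → ℕ} → (∀ w → f w ≡ g w) → ∑ᵛ n f ≡ ∑ᵛ n g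
  ∑ᵛ-cong zero    f≗g = f≗g []
  ∑ᵛ-cong (suc n) f≗g = sum-cong-≗ {k} (λ a → ∑ᵛ-cong n (f≗g ∘ (a ∷_)))

  ∑ᵛ-distrib-+ : ∀ n (f g : Vertex n k → ℕ) → ∑ᵛ n (λ w → f w + g w) ≡ ∑ᵛ n f + ∑ᵛ n g
  ∑ᵛ-distrib-+ zero    f g = refl
  ∑ᵛ-distrib-+ (suc n) f g = trans (sum-cong-≗ {k} (λ a → ∑ᵛ-distrib-+ n (f ∘ (a ∷_)) (g ∘ (a ∷_))))
    (∑-distrib-+ (λ a → ∑ᵛ n (f ∘ (a ∷_))) (λ a → ∑ᵛ n (g ∘ (a ∷_))))

  sum-allVertices : ∀ n (g : Vertex n k → ℕ) → ListAction.sum (map g (allVertices n k)) ≡ ∑ᵛ n g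
  sum-allVertices zero    g = +-identityʳ (g [])
  sum-allVertices (suc n) g = begin
    ListAction.sum (map g (concatMap (λ a → map (a ∷_) (allVertices n k)) (allFin k)))
      ≡⟨ sum-concatMap (λ a → map (a ∷_) (allVertices n k)) g (allFin k) ⟩
    ListAction.sum (map (λ a → ListAction.sum (map g (map (a ∷_) (allVertices n k)))) (allFin k))
      ≡⟨ cong ListAction.sum (map-cong (λ a → trans (cong ListAction.sum (sym (map-∘ (allVertices n k))))
                                                   (sum-allVertices n (g ∘ (a ∷_)))) (allFin k)) ⟩
    ListAction.sum (map (λ a → ∑ᵛ n (g ∘ (a ∷_))) (allFin k))
      ≡⟨ sum-map-allFin (λ a → ∑ᵛ n (g ∘ (a ∷_))) ⟩
    ∑ᵛ (suc n) g ∎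
    where open ≡-Reasoning

module _ {k : ℕ} where

  entry : Fin (suc k) → Maybe (Fin (suc k))
  entry fzero    = nothing
  entry (fsuc a) = just (fsuc a)

  lastNonzero-∷ : ∀ {n} (a : Fin (suc k)) (w : Vertex n (suc k)) →
    lastNonzero (a ∷ w) ≡ lastNonzero w <∣> entry a
  lastNonzero-∷ a w with lastNonzero w
  ... | just b  = refl
  ... | nothing with a
  ...   | fzero  = refl
  ...   | fsuc _ = refl

  𝟙-<∣>≟nothing : (m e : Maybe (Fin (suc k))) →
    𝟙 ((m <∣> e) ≟ᵐ nothing) ≡ 𝟙 (m ≟ᵐ nothing) * 𝟙 (e ≟ᵐ nothing)
  𝟙-<∣>≟nothing (just _) e = refl
  𝟙-<∣>≟nothing nothing  e = sym (+-identityʳ _)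

  𝟙-<∣>≟just : (m e : Maybe (Fin (suc k))) (t : Fin (suc k)) →
    𝟙 ((m <∣> e) ≟ᵐ just t) ≡ 𝟙 (m ≟ᵐ just t) + 𝟙 (m ≟ᵐ nothing) * 𝟙 (e ≟ᵐ just t)
  𝟙-<∣>≟just (just _) e t = sym (+-identityʳ _)
  𝟙-<∣>≟just nothing  e t = sym (+-identityʳ _)

  𝟙-entry≟nothing : (a : Fin (suc k)) → 𝟙 (entry a ≟ᵐ nothing) ≡ 𝟙 (a ≟ fzero)
  𝟙-entry≟nothing fzero    = refl
  𝟙-entry≟nothing (fsuc _) = refl

  𝟙-entry≟just : (a t : Fin (suc k)) → toℕ t ≢ 0 → 𝟙 (entry a ≟ᵐ just t) ≡ 𝟙 (a ≟ t)
  𝟙-entry≟just fzero    fzero    t≢0 = contradiction refl t≢0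
  𝟙-entry≟just fzero    (fsuc _) t≢0 = refl
  𝟙-entry≟just (fsuc _) t        t≢0 = refl

  zeros : ∀ n → Vertex n (suc k)
  zeros n = replicate n fzero

  sumℕ-zeros : ∀ n → sumℕ (zeros n) ≡ 0
  sumℕ-zeros zero    = refl
  sumℕ-zeros (suc n) = sumℕ-zeros n

  ∑ᵛ-select-zeros : ∀ n (g : Vertex n (suc k) → ℕ) →
    ∑ᵛ n (λ w → 𝟙 (lastNonzero w ≟ᵐ nothing) * g w) ≡ g (zeros n)
  ∑ᵛ-select-zeros zero    g = +-identityʳ (g [])
  ∑ᵛ-select-zeros (suc n) g = begin
    ∑[ a < suc k ] ∑ᵛ n (λ w → 𝟙 (lastNonzero (a ∷ w) ≟ᵐ nothing) * g (a ∷ w))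
      ≡⟨ sum-cong-≗ {suc k} (λ a → ∑ᵛ-cong n (λ w → factor a w)) ⟩
    ∑[ a < suc k ] ∑ᵛ n (λ w → 𝟙 (lastNonzero w ≟ᵐ nothing) * (𝟙 (a ≟ fzero) * g (a ∷ w)))
      ≡⟨ sum-cong-≗ {suc k} (λ a → ∑ᵛ-select-zeros n (λ w → 𝟙 (a ≟ fzero) * g (a ∷ w))) ⟩
    ∑[ a < suc k ] (𝟙 (a ≟ fzero) * g (a ∷ zeros n))
      ≡⟨ ∑-select fzero (λ a → g (a ∷ zeros n)) ⟩
    g (zeros (suc n)) ∎
    where
    open ≡-Reasoning
    factor : ∀ a w → 𝟙 (lastNonzero (a ∷ w) ≟ᵐ nothing) * g (a ∷ w)
                   ≡ 𝟙 (lastNonzero w ≟ᵐ nothing) * (𝟙 (a ≟ fzero) * g (a ∷ w))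
    factor a w = begin
      𝟙 (lastNonzero (a ∷ w) ≟ᵐ nothing) * g (a ∷ w)
        ≡⟨ cong (λ m → 𝟙 (m ≟ᵐ nothing) * g (a ∷ w)) (lastNonzero-∷ a w) ⟩
      𝟙 ((lastNonzero w <∣> entry a) ≟ᵐ nothing) * g (a ∷ w)
        ≡⟨ cong (_* g (a ∷ w)) (trans (𝟙-<∣>≟nothing (lastNonzero w) (entry a))
                                       (cong (𝟙 (lastNonzero w ≟ᵐ nothing) *_) (𝟙-entry≟nothing a))) ⟩
      𝟙 (lastNonzero w ≟ᵐ nothing) * 𝟙 (a ≟ fzero) * g (a ∷ w)
        ≡⟨ *-assoc (𝟙 (lastNonzero w ≟ᵐ nothing)) _ _ ⟩
      𝟙 (lastNonzero w ≟ᵐ nothing) * (𝟙 (a ≟ fzero) * g (a ∷ w)) ∎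

repunit : ℕ → ℕ → ℕ
repunit b zero    = 0
repunit b (suc m) = b * repunit b m + 1

repunit[1+b]*b+1≡[1+b]^m : ∀ b m → repunit (suc b) m * b + 1 ≡ suc b ^ m
repunit[1+b]*b+1≡[1+b]^m b zero    = refl
repunit[1+b]*b+1≡[1+b]^m b (suc m) =
  trans (regroup (repunit (suc b) m) b) (cong (suc b *_) (repunit[1+b]*b+1≡[1+b]^m b m))
  where
  open +-*-Solver
  regroup : ∀ r b → (suc b * r + 1) * b + 1 ≡ suc b * (r * b + 1)
  regroup = solve 2 (λ r b → ((con 1 :+ b) :* r :+ con 1) :* b :+ con 1 := (con 1 :+ b) :* (r :* b :+ con 1)) refl

repunit[1+b]≡[[1+b]^m∸1]/b : ∀ b m .{{_ : NonZero b}} → repunit (suc b) m ≡ (suc b ^ m ∸ 1) / b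
repunit[1+b]≡[[1+b]^m∸1]/b b m = begin
  repunit (suc b) m                      ≡⟨ m*n/n≡m (repunit (suc b) m) b ⟨
  repunit (suc b) m * b / b              ≡⟨ cong (_/ b) (m+n∸n≡m (repunit (suc b) m * b) 1) ⟨
  (repunit (suc b) m * b + 1 ∸ 1) / b    ≡⟨ cong (λ x → (x ∸ 1) / b) (repunit[1+b]*b+1≡[1+b]^m b m) ⟩
  (suc b ^ m ∸ 1) / b                    ∎
  where open ≡-Reasoning

module CountY {k : ℕ} (s t : Fin (suc k)) (t≢0 : toℕ t ≢ 0) where

  ≡ₖs : ℕ → ℕ
  ≡ₖs x = 𝟙 (x % suc k ℕ.≟ toℕ s)

  ≡ₖs-periodic : ∀ x → ≡ₖs (x + suc k) ≡ ≡ₖs x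
  ≡ₖs-periodic x = cong (λ r → 𝟙 (r ℕ.≟ toℕ s)) ([m+n]%n≡m%n x (suc k))

  ∑-≡ₖs-window : ∀ x → ∑[ a < suc k ] ≡ₖs (x + toℕ a) ≡ 1
  ∑-≡ₖs-window x = begin
    ∑[ a < suc k ] ≡ₖs (x + toℕ a)  ≡⟨ ∑-periodic-window (suc k) ≡ₖs ≡ₖs-periodic x ⟩
    ∑[ a < suc k ] ≡ₖs (toℕ a)      ≡⟨ sum-cong-≗ {suc k} (λ a → trans (𝟙-toℕ%≟ a s) (sym (*-identityʳ _))) ⟩
    ∑[ a < suc k ] (𝟙 (a ≟ s) * 1)  ≡⟨ ∑-select s (λ _ → 1) ⟩
    1                               ∎
    where open ≡-Reasoning

  -- inYFrom c w is the indicator of w ∈ Y(s − c, t); shifting by the offset c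
  -- keeps the recursion free of subtraction modulo k.
  inYFrom : ∀ {n} → ℕ → Vertex n (suc k) → ℕ
  inYFrom c w = ≡ₖs (c + sumℕ w) * 𝟙 (lastNonzero w ≟ᵐ just t)

  countYFrom : ℕ → ℕ → ℕ
  countYFrom n c = ∑ᵛ n (inYFrom c)

  countYFrom-zero : ∀ c → countYFrom 0 c ≡ 0
  countYFrom-zero c = *-zeroʳ (≡ₖs (c + 0))

  inYFrom-zeroTail : ∀ {n} → ℕ → Fin (suc k) → Vertex n (suc k) → ℕ
  inYFrom-zeroTail c a w = 𝟙 (lastNonzero w ≟ᵐ nothing) * (𝟙 (a ≟ t) * ≡ₖs (c + toℕ a + sumℕ w))

  inYFrom-∷ : ∀ {n} c (a : Fin (suc k)) (w : Vertex n (suc k)) →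
    inYFrom c (a ∷ w) ≡ inYFrom (c + toℕ a) w + inYFrom-zeroTail c a w
  inYFrom-∷ c a w = begin
    ≡ₖs (c + (toℕ a + sumℕ w)) * 𝟙 (lastNonzero (a ∷ w) ≟ᵐ just t)
      ≡⟨ cong₂ _*_ (cong ≡ₖs (sym (+-assoc c (toℕ a) (sumℕ w)))) last≟t ⟩
    h * (𝟙 (lastNonzero w ≟ᵐ just t) + 𝟙 (lastNonzero w ≟ᵐ nothing) * 𝟙 (a ≟ t))
      ≡⟨ distribute h (𝟙 (lastNonzero w ≟ᵐ just t)) (𝟙 (lastNonzero w ≟ᵐ nothing)) (𝟙 (a ≟ t)) ⟩
    h * 𝟙 (lastNonzero w ≟ᵐ just t) + 𝟙 (lastNonzero w ≟ᵐ nothing) * (𝟙 (a ≟ t) * h) ∎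
    where
    open ≡-Reasoning
    h : ℕ
    h = ≡ₖs (c + toℕ a + sumℕ w)
    last≟t : 𝟙 (lastNonzero (a ∷ w) ≟ᵐ just t)
           ≡ 𝟙 (lastNonzero w ≟ᵐ just t) + 𝟙 (lastNonzero w ≟ᵐ nothing) * 𝟙 (a ≟ t)
    last≟t = begin
      𝟙 (lastNonzero (a ∷ w) ≟ᵐ just t)
        ≡⟨ cong (λ m → 𝟙 (m ≟ᵐ just t)) (lastNonzero-∷ a w) ⟩
      𝟙 ((lastNonzero w <∣> entry a) ≟ᵐ just t)
        ≡⟨ 𝟙-<∣>≟just (lastNonzero w) (entry a) t ⟩
      𝟙 (lastNonzero w ≟ᵐ just t) + 𝟙 (lastNonzero w ≟ᵐ nothing) * 𝟙 (entry a ≟ᵐ just t)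
        ≡⟨ cong (λ x → 𝟙 (lastNonzero w ≟ᵐ just t) + 𝟙 (lastNonzero w ≟ᵐ nothing) * x) (𝟙-entry≟just a t t≢0) ⟩
      𝟙 (lastNonzero w ≟ᵐ just t) + 𝟙 (lastNonzero w ≟ᵐ nothing) * 𝟙 (a ≟ t) ∎
    open +-*-Solver
    distribute : ∀ h x y z → h * (x + y * z) ≡ h * x + y * (z * h)
    distribute = solve 4 (λ h x y z → h :* (x :+ y :* z) := h :* x :+ y :* (z :* h)) refl

  countYFrom-suc : ∀ n c → countYFrom (suc n) c ≡ ∑[ a < suc k ] countYFrom n (c + toℕ a) + ≡ₖs (c + toℕ t)
  countYFrom-suc n c = begin
    ∑[ a < suc k ] ∑ᵛ n (λ w → inYFrom c (a ∷ w))
      ≡⟨ sum-cong-≗ {suc k} (λ a → trans (∑ᵛ-cong {suc k} n (inYFrom-∷ c a))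
                                         (∑ᵛ-distrib-+ n (inYFrom (c + toℕ a)) (inYFrom-zeroTail c a))) ⟩
    ∑[ a < suc k ] (rest a + ∑ᵛ n (inYFrom-zeroTail c a))
      ≡⟨ sum-cong-≗ {suc k} (λ a → cong (rest a +_) (∑ᵛ-select-zeros {k} n (λ w → 𝟙 (a ≟ t) * ≡ₖs (c + toℕ a + sumℕ w)))) ⟩
    ∑[ a < suc k ] (rest a + 𝟙 (a ≟ t) * ≡ₖs (c + toℕ a + z))
      ≡⟨ ∑-distrib-+ {suc k} rest (λ a → 𝟙 (a ≟ t) * ≡ₖs (c + toℕ a + z)) ⟩
    ∑[ a < suc k ] rest a + ∑[ a < suc k ] (𝟙 (a ≟ t) * ≡ₖs (c + toℕ a + z))
      ≡⟨ cong (∑[ a < suc k ] rest a +_) (∑-select t (λ a → ≡ₖs (c + toℕ a + z))) ⟩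
    ∑[ a < suc k ] rest a + ≡ₖs (c + toℕ t + z)
      ≡⟨ cong (λ x → ∑[ a < suc k ] rest a + ≡ₖs x) (trans (cong (c + toℕ t +_) (sumℕ-zeros {k} n)) (+-identityʳ _)) ⟩
    ∑[ a < suc k ] rest a + ≡ₖs (c + toℕ t) ∎
    where
    open ≡-Reasoning
    rest : Fin (suc k) → ℕ
    rest a = countYFrom n (c + toℕ a)
    z : ℕ
    z = sumℕ (zeros {k} n)

  countYFrom-formula : ∀ m c → countYFrom (suc m) c ≡ repunit (suc k) m + ≡ₖs (c + toℕ t)
  countYFrom-formula zero    c = begin
    countYFrom 1 c                                            ≡⟨ countYFrom-suc 0 c ⟩
    ∑[ a < suc k ] countYFrom 0 (c + toℕ a) + ≡ₖs (c + toℕ t)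
      ≡⟨ cong (_+ ≡ₖs (c + toℕ t)) (trans (sum-cong-≗ {suc k} (countYFrom-zero ∘ (c +_) ∘ toℕ))
                                          (sum-replicate-zero (suc k))) ⟩
    ≡ₖs (c + toℕ t)                                           ∎
    where open ≡-Reasoning
  countYFrom-formula (suc m) c = begin
    countYFrom (suc (suc m)) c                                ≡⟨ countYFrom-suc (suc m) c ⟩
    ∑[ a < suc k ] countYFrom (suc m) (c + toℕ a) + ≡ₖs (c + toℕ t)
      ≡⟨ cong (_+ ≡ₖs (c + toℕ t)) (sum-cong-≗ {suc k} (λ a → countYFrom-formula m (c + toℕ a))) ⟩
    ∑[ a < suc k ] (repunit (suc k) m + ≡ₖs (c + toℕ a + toℕ t)) + ≡ₖs (c + toℕ t)
      ≡⟨ cong (_+ ≡ₖs (c + toℕ t)) (∑-distrib-+ {suc k} (λ _ → repunit (suc k) m) (λ a → ≡ₖs (c + toℕ a + toℕ t))) ⟩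
    ∑[ a < suc k ] repunit (suc k) m + ∑[ a < suc k ] ≡ₖs (c + toℕ a + toℕ t) + ≡ₖs (c + toℕ t)
      ≡⟨ cong (_+ ≡ₖs (c + toℕ t)) (cong₂ _+_ (∑-const (suc k) (repunit (suc k) m)) window) ⟩
    repunit (suc k) (suc m) + ≡ₖs (c + toℕ t)                 ∎
    where
    open ≡-Reasoning
    window : ∑[ a < suc k ] ≡ₖs (c + toℕ a + toℕ t) ≡ 1
    window = trans (sum-cong-≗ {suc k} (λ a → cong ≡ₖs (xy∙z≈xz∙y c (toℕ a) (toℕ t))))
                   (∑-≡ₖs-window (c + toℕ t))

  cardY≡repunit+𝟙 : ∀ m → cardY (suc m) (suc k) s t ≡ repunit (suc k) m + 𝟙 (t ≟ s)
  cardY≡repunit+𝟙 m = begin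
    cardY (suc m) (suc k) s t
      ≡⟨ length-filter≡sum-𝟙 (InY? s t) (allVertices (suc m) (suc k)) ⟩
    ListAction.sum (map (𝟙 ∘ InY? s t) (allVertices (suc m) (suc k)))
      ≡⟨ sum-allVertices (suc m) (𝟙 ∘ InY? s t) ⟩
    ∑ᵛ (suc m) (𝟙 ∘ InY? s t)
      ≡⟨ ∑ᵛ-cong (suc m) (λ v → 𝟙-×-dec (sumℕ v % suc k ℕ.≟ toℕ s) (lastNonzero v ≟ᵐ just t)) ⟩
    countYFrom (suc m) 0
      ≡⟨ countYFrom-formula m 0 ⟩
    repunit (suc k) m + ≡ₖs (toℕ t)
      ≡⟨ cong (repunit (suc k) m +_) (𝟙-toℕ%≟ t s) ⟩
    repunit (suc k) m + 𝟙 (t ≟ s) ∎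
    where open ≡-Reasoning

lemma9 : (n k : ℕ) → 1 ≤ n → 2 ≤ k → .{{_ : NonZero k}} → .{{_ : NonZero (k ∸ 1)}} →
    (s t : Fin k) → toℕ t ≢ 0 →
    (s ≡ t → cardY n k s t ≡ (k ^ (n ∸ 1) ∸ 1) / (k ∸ 1) + 1) ×
    (s ≢ t → cardY n k s t ≡ (k ^ (n ∸ 1) ∸ 1) / (k ∸ 1))
lemma9 (suc m) k@(suc (suc k-2)) _ _ s t t≢0 =
    (λ s≡t → trans card (cong (R +_) (𝟙-yes (sym s≡t) (t ≟ s))))
  , (λ s≢t → trans card (trans (cong (R +_) (𝟙-no (s≢t ∘ sym) (t ≟ s))) (+-identityʳ R)))
  where
  R : ℕ
  R = (k ^ m ∸ 1) / suc k-2
  card : cardY (suc m) k s t ≡ R + 𝟙 (t ≟ s)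
  card = trans (CountY.cardY≡repunit+𝟙 s t t≢0 m) (cong (_+ 𝟙 (t ≟ s)) (repunit[1+b]≡[[1+b]^m∸1]/b (suc k-2) m))
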